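{- Let $G_1$ and $G_2$ be two vertex-disjoint 2-edge-colored simple graphs with Hamiltonian alternating cycles $C_1=x_0x_1\cdots x_{2n-1}x_0$ and $C_2=y_0y_1\cdots y_{2m-1}y_0$, respectively, and let $G\in G_1\oplus G_2$. Suppose there is no good pair in $G$, and for each $i\in\{1,2\}$ the cycle $C_i$ contains a vertex which is non-singular with respect to $C_{3-i}$. Let $m_1=\min\{n,m\}$ and $M_2=\max\{n,m\}$. Then for each vertex $v\in V(G)$ and each even integer $\ell\in[4m_1,2M_2]$, there is an alternating cycle of length $\ell$ in $G$ passing through $v$.
   Context: All graphs are simple and 2-edge-colored with colors red and blue. An alternating path/cycle is one in which any two consecutive edges have different colors; a Hamiltonian alternating cycle is an alternating cycle through all vertices of the graph. For vertex-disjoint 2-edge-colored graphs $G_1,G_2$, the colored generalized sum $G_1\oplus G_2$ is the set of 2-edge-colored graphs $G$ with $V(G)=V(G_1)\cup V(G_2)$, $G\langle V(G_i)\rangle$ equal to $G_i$ with its coloring for $i=1,2$, and exactly one edge (of arbitrary fixed color) between every $u\in V(G_1)$ and $w\in V(G_2)$; these latter edges are called exterior. For a vertex $v$ of an alternating cycle $C$, $v^r$ (resp. $v^b$) denotes the vertex of $C$ such that $vv^r\in E(C)$ is red (resp. $vv^b\in E(C)$ is blue). For an edge $vw$ with $v\in V(C_1)$, $w\in V(C_2)$: if $vw$ is red, the pair $vw, v^rw^r$ is a good pair if $v^rw^r$ is red; if $vw$ is blue, the pair $vw,v^bw^b$ is a good pair if $v^bw^b$ is blue (here $v^r,v^b$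 are taken in $C_1$ and $w^r,w^b$ in $C_2$). A vertex $v\in V(C_i)$ is red-singular (resp. blue-singular) with respect to $C_{3-i}$ if all edges $vu$ with $u\in V(C_{3-i})$ are red (resp. blue); singular means red- or blue-singular, and non-singular means not singular. For integers $a\le b$, $[a,b]=\{a,a+1,\ldots,b\}$. -}

module Defs where

open import Data.Nat using (ℕ; zero; suc; _+_; _*_; _∸_; _≤_; _<_; _⊔_; _⊓_)
open import Data.Fin using (Fin)
open import Data.Sum using (_⊎_; inj₁; inj₂)
open import Data.Product using (_×_; _,_; ∃; ∃-syntax)
open import Data.Maybe using (Maybe; just; nothing)
open import Relation.Binary.PropositionalEquality using (_≡_; _≢_)
open import Relation.Nullary using (¬_)

data Colour : Set where
  red blue : Colour

flip : Colour → Colour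
flip red  = blue
flip blue = red

record ColGraph (V : Set) : Set where
  field
    E      : V → V → Maybe Colour
    sym    : ∀ u v → E u v ≡ E v u
    noLoop : ∀ v → E v v ≡ nothing
open ColGraph public

record AltCycle {V : Set} (G : ColGraph V) (ℓ : ℕ) (c : ℕ → V) : Set where
  field
    long     : 3 ≤ ℓ
    periodic : ∀ i → c (i + ℓ) ≡ c i
    distinct : ∀ i j → i < ℓ → j < ℓ → c i ≡ c j → i ≡ j
    altern   : ∀ i → ∃[ κ ] (E G (c i) (c (suc i)) ≡ just κ
                           × E G (c (suc i)) (c (suc (suc i))) ≡ just (flip κ))

OnCycle : {V : Set} → ℕ → (ℕ → V) → V → Set
OnCycle ℓ c v = ∃[ i ] (i < ℓ × c i ≡ v)

-- u = v^κ on the cycle c of length ℓ: u is a cycle-neighbour of v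
-- and the edge vu (an edge of the cycle) has colour κ.
CycNbr : {V : Set} → ColGraph V → ℕ → (ℕ → V) → Colour → V → V → Set
CycNbr G ℓ c κ v u =
  ∃[ i ] (c i ≡ v × (u ≡ c (suc i) ⊎ u ≡ c (i + (ℓ ∸ 1))) × E G v u ≡ just κ)

-- Colored generalized sum: the graph G on V₁ ⊎ V₂ contains exactly one
-- (coloured) edge between every u ∈ V₁ and w ∈ V₂.  (G⟨V₁⟩ and G⟨V₂⟩
-- are G₁ and G₂ by definition.)
InGenSum : {p q : ℕ} → ColGraph (Fin p ⊎ Fin q) → Set
InGenSum G = ∀ u w → E G (inj₁ u) (inj₂ w) ≢ nothing

GoodPair : {p q : ℕ} → ColGraph (Fin p ⊎ Fin q) →
           ℕ → (ℕ → Fin p ⊎ Fin q) → ℕ → (ℕ → Fin p ⊎ Fin q) → Set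
GoodPair G ℓ₁ c₁ ℓ₂ c₂ =
  ∃[ κ ] ∃[ v ] ∃[ w ] ∃[ v' ] ∃[ w' ]
    (OnCycle ℓ₁ c₁ v × OnCycle ℓ₂ c₂ w × E G v w ≡ just κ
     × CycNbr G ℓ₁ c₁ κ v v' × CycNbr G ℓ₂ c₂ κ w w'
     × E G v' w' ≡ just κ)

Singular : {V : Set} → ColGraph V → Colour → ℕ → (ℕ → V) → V → Set
Singular G κ ℓ c v = ∀ u → OnCycle ℓ c u → E G v u ≡ just κ

NonSingular : {V : Set} → ColGraph V → ℕ → (ℕ → V) → V → Set
NonSingular G ℓ c v = ¬ Singular G red ℓ c v × ¬ Singular G blue ℓ c v

-- Let χ i j be the colour of the exterior edge x_i y_j.  When the cycle edges
-- x_i x_{i+1} and y_j y_{j+1} have the same colour κ, the absence of good pairs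
-- says that χ i j = κ forces χ (i+1) (j+1) ≠ κ; so once χ agrees with
-- the x-edge colour along this diagonal it does so forever, and going once
-- around both cycles shows that χ flips at every diagonal step (likewise along
-- anti-diagonals (i,j) ↦ (i+1,j−1) when the two colours differ).  Hence whether
-- x_i y_j has the colour of y_j y_{j+1} is invariant along these diagonals.  If
-- in some row i this agreement switches from false at column j to true at column
-- j + 2k − 2, the path y_j … y_{j+2k−2} closes through x_i to an alternating
-- 2k-cycle; a switch over 2k − 4 columns closes through x_i and a neighbour of
-- x_i instead; diagonal invariance carries one switch to every vertex.  If row 0
-- has neither kind of switch, its agreement pattern has period 2, so the whole
-- agreement table is constant or alternating, making every column, respectively
-- every row, of χ monochromatic: this contradicts non-singularity.

module Submission where

open import Defs hiding (sym)
open import Data.Nat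
open import Data.Nat.Properties
open import Data.Nat.DivMod
open import Data.Nat.Tactic.RingSolver using (solve-∀)
open import Algebra.Properties.CommutativeSemigroup +-commutativeSemigroup using (xy∙z≈xz∙y)
open import Data.Bool using (Bool; true; false; not)
open import Data.Bool.Properties using (not-involutive; ¬-not; ⇔→≡) renaming (_≟_ to _≟ᵇ_)
open import Data.Maybe using (just; nothing; fromMaybe)
open import Data.Maybe.Properties using (just-injective)
open import Data.Sum using (_⊎_; inj₁; inj₂)
open import Data.Product using (_×_; _,_; ∃-syntax; proj₁; proj₂)
open import Data.Empty using (⊥-elim)
open import Data.Fin using (Fin; toℕ; fromℕ<)
open import Data.Fin.Properties using (any?; all?; ¬∀⟶∃¬; toℕ-fromℕ<)
open import Function.Bundles using (mk⇔)
open import Relation.Binary.PropositionalEquality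
open import Relation.Binary.Definitions using (tri<; tri≈; tri>)
open import Relation.Nullary using (¬_; Dec; yes; no)
open import Relation.Nullary.Decidable using (_×-dec_)
open import Function.Base using (_∘_)

flip-involutive : ∀ κ → flip (flip κ) ≡ κ
flip-involutive red  = refl
flip-involutive blue = refl

flip-≢ : ∀ κ → flip κ ≢ κ
flip-≢ red  ()
flip-≢ blue ()

_≟ᶜ_ : (κ κ′ : Colour) → Dec (κ ≡ κ′)
red  ≟ᶜ red  = yes refl
red  ≟ᶜ blue = no λ ()
blue ≟ᶜ red  = no λ ()
blue ≟ᶜ blue = yes refl

≢⇒≡flip : ∀ {κ κ′} → κ ≢ κ′ → κ ≡ flip κ′
≢⇒≡flip {red}  {red}  κ≢κ′ = ⊥-elim (κ≢κ′ refl)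
≢⇒≡flip {red}  {blue} _    = refl
≢⇒≡flip {blue} {red}  _    = refl
≢⇒≡flip {blue} {blue} κ≢κ′ = ⊥-elim (κ≢κ′ refl)

flip^ : ℕ → Colour → Colour
flip^ zero    κ = κ
flip^ (suc r) κ = flip (flip^ r κ)

flip^-even : ∀ s κ → flip^ (2 * s) κ ≡ κ
flip^-even zero    κ = refl
flip^-even (suc s) κ rewrite +-suc s (s + 0) = trans (flip-involutive _) (flip^-even s κ)

flip^-odd : ∀ s κ → flip^ (suc (2 * s)) κ ≡ flip κ
flip^-odd s κ = cong flip (flip^-even s κ)

flip^-flip : ∀ r κ → flip^ r (flip κ) ≡ flip (flip^ r κ)
flip^-flip zero    κ = refl
flip^-flip (suc r) κ = cong flip (flip^-flip r κ)

_==ᶜ_ : Colour → Colour → Bool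
red  ==ᶜ red  = true
red  ==ᶜ blue = false
blue ==ᶜ red  = false
blue ==ᶜ blue = true

==ᶜ-flip : ∀ κ κ′ → (flip κ ==ᶜ flip κ′) ≡ (κ ==ᶜ κ′)
==ᶜ-flip red  red  = refl
==ᶜ-flip red  blue = refl
==ᶜ-flip blue red  = refl
==ᶜ-flip blue blue = refl

==ᶜ-true : ∀ {κ κ′} → (κ ==ᶜ κ′) ≡ true → κ ≡ κ′
==ᶜ-true {red}  {red}  _ = refl
==ᶜ-true {blue} {blue} _ = refl

==ᶜ-false : ∀ {κ κ′} → (κ ==ᶜ κ′) ≡ false → κ ≡ flip κ′
==ᶜ-false {red}  {blue} _ = refl
==ᶜ-false {blue} {red}  _ = refl

+-suc-* : ∀ j t b → j + suc t * b ≡ j + t * b + b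
+-suc-* = solve-∀

periodic-* : ∀ {A : Set} (f : ℕ → A) P → (∀ i → f (i + P) ≡ f i) → ∀ q i → f (i + q * P) ≡ f i
periodic-* f P per zero    i = cong f (+-identityʳ i)
periodic-* f P per (suc q) i = trans (cong f (sym (+-assoc i P (q * P)))) (trans (periodic-* f P per q (i + P)) (per i))

[1+m]%n≡[1+m%n]%n : ∀ m n .{{_ : NonZero n}} → suc m % n ≡ suc (m % n) % n
[1+m]%n≡[1+m%n]%n m n = trans (cong (λ x → suc x % n) (m≡m%n+[m/n]*n m n)) ([m+kn]%n≡m%n (suc (m % n)) (m / n) n)

suc-%-wrap : ∀ {A : Set} (w : ℕ → A) L .{{_ : NonZero L}} → w L ≡ w 0 →
             ∀ t → w (suc t % L) ≡ w (suc (t % L))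
suc-%-wrap w L closed t with suc (t % L) <? L
... | yes 1+r<L = cong w (trans ([1+m]%n≡[1+m%n]%n t L) (m<n⇒m%n≡m 1+r<L))
... | no  1+r≮L = trans (cong w (trans ([1+m]%n≡[1+m%n]%n t L) (trans (cong (_% L) 1+r≡L) (n%n≡0 L))))
                        (trans (sym closed) (cong w (sym 1+r≡L)))
  where
  1+r≡L : suc (t % L) ≡ L
  1+r≡L = ≤-antisym (m%n<n t L) (≮⇒≥ 1+r≮L)

splice : ∀ {A : Set} → ℕ → (ℕ → A) → (ℕ → A) → ℕ → A
splice a p q t with t ≤? a
... | yes _ = p t
... | no  _ = q (t ∸ suc a)

splice-≤ : ∀ {A : Set} a (p q : ℕ → A) {t} → t ≤ a → splice a p q t ≡ p t
splice-≤ a p q {t} t≤a with t ≤? a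
... | yes _   = refl
... | no  t≰a = ⊥-elim (t≰a t≤a)

splice-> : ∀ {A : Set} a (p q : ℕ → A) u → splice a p q (suc a + u) ≡ q u
splice-> a p q u with suc a + u ≤? a
... | yes 1+a+u≤a = ⊥-elim (m+1+n≰m a (≤-trans (≤-reflexive (+-suc a u)) 1+a+u≤a))
... | no  _       = cong q (m+n∸m≡n (suc a) u)

split-< : ∀ a b {t} → t < suc a + b → t ≤ a ⊎ ∃[ u ] (u < b × t ≡ suc a + u)
split-< a b {t} t<L with t ≤? a
... | yes t≤a = inj₁ t≤a
... | no  t≰a = inj₂ (t ∸ suc a , +-cancelˡ-< (suc a) _ b (subst (_< suc a + b) t≡ t<L) , t≡)
  where
  t≡ : t ≡ suc a + (t ∸ suc a)
  t≡ = sym (m+[n∸m]≡n (≰⇒> t≰a))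

[m+d]%n≢m : ∀ {m d n} .{{_ : NonZero n}} → m < n → 0 < d → d < n → (m + d) % n ≢ m
[m+d]%n≢m {m} {suc d} {n} m<n _ d<n eq with m + suc d <? n
... | yes m+d<n = m+1+n≢m m (trans (sym (m<n⇒m%n≡m m+d<n)) eq)
... | no  m+d≮n = <-irrefl d≡n d<n
  where
  n≤m+d : n ≤ m + suc d
  n≤m+d = ≮⇒≥ m+d≮n
  wrapped : m + suc d ∸ n ≡ m
  wrapped = trans (sym (m<n⇒m%n≡m (+-cancelʳ-< n _ n (subst (_< n + n) (sym (m∸n+n≡m n≤m+d)) (+-mono-< m<n d<n)))))
                  (trans (m≤n⇒[n∸m]%m≡n%m n≤m+d) eq)
  d≡n : suc d ≡ n
  d≡n = +-cancelˡ-≡ m (suc d) n (trans (sym (m∸n+n≡m n≤m+d)) (cong (_+ n) wrapped))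

module _ {V : Set} (G : ColGraph V) where

  closedAltWalk⇒AltCycle : ∀ s κ (w : ℕ → V) → let L = 2 * suc (suc s) in
    w L ≡ w 0 →
    (∀ i j → i < L → j < L → w i ≡ w j → i ≡ j) →
    (∀ r → r < L → E G (w r) (w (suc r)) ≡ just (flip^ r κ)) →
    AltCycle G L (λ t → w (t % L))
  closedAltWalk⇒AltCycle s κ w closed distinct edge = record
    { long     = s≤s (s≤s (≤-trans (s≤s z≤n) (m≤n+m _ s)))
    ; periodic = λ i → cong w ([m+n]%n≡m%n i L)
    ; distinct = λ i j i<L j<L eq → distinct i j i<L j<L
                   (subst₂ (λ a b → w a ≡ w b) (m<n⇒m%n≡m i<L) (m<n⇒m%n≡m j<L) eq)
    ; altern   = λ t → flip^ (t % L) κ , first t , second t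
    }
    where
    L : ℕ
    L = 2 * suc (suc s)
    first : ∀ t → E G (w (t % L)) (w (suc t % L)) ≡ just (flip^ (t % L) κ)
    first t = trans (cong (E G _) (suc-%-wrap w L closed t)) (edge (t % L) (m%n<n t L))
    second : ∀ t → E G (w (suc t % L)) (w (suc (suc t) % L)) ≡ just (flip (flip^ (t % L) κ))
    second t = begin
      E G (w (suc t % L)) (w (suc (suc t) % L))  ≡⟨ cong (E G _) (suc-%-wrap w L closed (suc t)) ⟩
      E G (w (suc t % L)) (w (suc (suc t % L)))  ≡⟨ edge (suc t % L) (m%n<n (suc t) L) ⟩
      just (flip^ (suc t % L) κ)                 ≡⟨ cong just (suc-%-wrap (λ r → flip^ r κ) L (flip^-even (suc (suc s)) κ) t) ⟩
      just (flip (flip^ (t % L) κ))              ∎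
      where open ≡-Reasoning

module AltCycleFacts {V : Set} {G : ColGraph V} {n : ℕ} {Z : ℕ → V} (cycle : AltCycle G (2 * suc n) Z) where
  open AltCycle cycle

  P : ℕ
  P = 2 * suc n

  Z-% : ∀ x → Z x ≡ Z (x % P)
  Z-% x = trans (cong Z (m≡m%n+[m/n]*n x P)) (periodic-* Z P periodic (x / P) (x % P))

  on-cycle : ∀ i → OnCycle P Z (Z i)
  on-cycle i = i % P , m%n<n i P , sym (Z-% i)

  window-injective-< : ∀ j {r r′} → r < r′ → r′ < P → Z (j + r) ≢ Z (j + r′)
  window-injective-< j {r} {r′} r<r′ r′<P eq = [m+d]%n≢m (m%n<n (j + r) P) (m<n⇒0<n∸m r<r′) d<P (sym same-%)
    where
    x d : ℕ
    x = (j + r) % P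
    d = r′ ∸ r
    d<P : d < P
    d<P = ≤-<-trans (m∸n≤m r′ r) r′<P
    shift : (j + r′) % P ≡ (x + d) % P
    shift = begin
      (j + r′) % P              ≡⟨ cong (λ z → (j + z) % P) (sym (m+[n∸m]≡n (<⇒≤ r<r′))) ⟩
      (j + (r + d)) % P         ≡⟨ cong (_% P) (sym (+-assoc j r d)) ⟩
      (j + r + d) % P           ≡⟨ %-distribˡ-+ (j + r) d P ⟩
      (x + d % P) % P           ≡⟨ cong (λ z → (x + z) % P) (m<n⇒m%n≡m d<P) ⟩
      (x + d) % P               ∎
      where open ≡-Reasoning
    same-% : x ≡ (x + d) % P
    same-% = trans (distinct x ((j + r′) % P) (m%n<n (j + r) P) (m%n<n (j + r′) P)
                      (trans (sym (Z-% (j + r))) (trans eq (Z-% (j + r′))))) shift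

  window-injective : ∀ j {r r′} → r < P → r′ < P → Z (j + r) ≡ Z (j + r′) → r ≡ r′
  window-injective j {r} {r′} r<P r′<P eq with <-cmp r r′
  ... | tri< r<r′ _ _ = ⊥-elim (window-injective-< j r<r′ r′<P eq)
  ... | tri≈ _ r≡r′ _ = r≡r′
  ... | tri> _ _ r′<r = ⊥-elim (window-injective-< j r′<r r<P (sym eq))

  col : ℕ → Colour
  col i = proj₁ (altern i)

  col-edge : ∀ i → E G (Z i) (Z (suc i)) ≡ just (col i)
  col-edge i = proj₁ (proj₂ (altern i))

  col-suc : ∀ i → col (suc i) ≡ flip (col i)
  col-suc i = just-injective (trans (sym (col-edge (suc i))) (proj₂ (proj₂ (altern i))))

  col-+ : ∀ i t → col (i + t) ≡ flip^ t (col i)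
  col-+ i zero    = cong col (+-identityʳ i)
  col-+ i (suc t) = trans (cong col (+-suc i t)) (trans (col-suc (i + t)) (cong flip (col-+ i t)))

  col-+even : ∀ i s → col (i + 2 * s) ≡ col i
  col-+even i s = trans (col-+ i (2 * s)) (flip^-even s (col i))

  col-+odd : ∀ i s → col (i + suc (2 * s)) ≡ flip (col i)
  col-+odd i s = trans (col-+ i (suc (2 * s))) (flip^-odd s (col i))

  col-+P : ∀ i → col (i + P) ≡ col i
  col-+P i = col-+even i (suc n)

  P∸1≡ : P ∸ 1 ≡ suc (2 * n)
  P∸1≡ = +-suc n (n + 0)

  col-+P∸1 : ∀ i → col (i + (P ∸ 1)) ≡ flip (col i)
  col-+P∸1 i = trans (cong (λ r → col (i + r)) P∸1≡) (col-+odd i n)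

  back-edge : ∀ i → E G (Z i) (Z (i + (P ∸ 1))) ≡ just (flip (col i))
  back-edge i = begin
    E G (Z i) (Z (i + (P ∸ 1)))                   ≡⟨ ColGraph.sym G _ _ ⟩
    E G (Z (i + (P ∸ 1))) (Z i)                   ≡⟨ cong (E G _) wraps ⟩
    E G (Z (i + (P ∸ 1))) (Z (suc (i + (P ∸ 1)))) ≡⟨ col-edge _ ⟩
    just (col (i + (P ∸ 1)))                      ≡⟨ cong just (col-+P∸1 i) ⟩
    just (flip (col i))                           ∎
    where
    open ≡-Reasoning
    wraps : Z i ≡ Z (suc (i + (P ∸ 1)))
    wraps = sym (trans (cong Z (sym (+-suc i (P ∸ 1)))) (periodic i))

  window+tail⇒AltCycle : ∀ s a b j (tl : ℕ → V) → let L = 2 * suc (suc s) in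
    a < P → suc a + b ≡ L → tl b ≡ Z j →
    (∀ u u′ → u < b → u′ < b → tl u ≡ tl u′ → u ≡ u′) →
    (∀ u t → u < b → tl u ≢ Z t) →
    E G (Z (j + a)) (tl 0) ≡ just (flip^ a (col j)) →
    (∀ u → u < b → E G (tl u) (tl (suc u)) ≡ just (flip^ (u + suc a) (col j))) →
    ∃[ c ] (AltCycle G L c × (∀ t → t ≤ a → OnCycle L c (Z (j + t)))
                           × (∀ u → u < b → OnCycle L c (tl u)))
  window+tail⇒AltCycle s a b j tl a<P a+b≡L closed tl-injective tl-off-cycle enter tl-edge =
    (λ t → w (t % L)) , closedAltWalk⇒AltCycle G s (col j) w w-closed w-distinct w-edge , on-window , on-tail
    where
    L : ℕ
    L = 2 * suc (suc s)
    w : ℕ → V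
    w = splice a (λ t → Z (j + t)) tl
    w-window : ∀ {t} → t ≤ a → w t ≡ Z (j + t)
    w-window = splice-≤ a _ tl
    w-tail : ∀ u → w (suc a + u) ≡ tl u
    w-tail = splice-> a _ tl
    position : ∀ {t} → t < L → t ≤ a ⊎ ∃[ u ] (u < b × t ≡ suc a + u)
    position {t} t<L = split-< a b (subst (t <_) (sym a+b≡L) t<L)
    w-closed : w L ≡ w 0
    w-closed = trans (cong w (sym a+b≡L))
                 (trans (w-tail b) (trans closed (trans (cong Z (sym (+-identityʳ j))) (sym (w-window z≤n)))))
    w-distinct : ∀ t t′ → t < L → t′ < L → w t ≡ w t′ → t ≡ t′
    w-distinct t t′ t<L t′<L eq with position t<L | position t′<L
    ... | inj₁ t≤a | inj₁ t′≤a =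
      window-injective j (≤-<-trans t≤a a<P) (≤-<-trans t′≤a a<P) (trans (sym (w-window t≤a)) (trans eq (w-window t′≤a)))
    ... | inj₁ t≤a | inj₂ (u′ , u′<b , refl) =
      ⊥-elim (tl-off-cycle u′ (j + t) u′<b (trans (sym (w-tail u′)) (trans (sym eq) (w-window t≤a))))
    ... | inj₂ (u , u<b , refl) | inj₁ t′≤a =
      ⊥-elim (tl-off-cycle u (j + t′) u<b (trans (sym (w-tail u)) (trans eq (w-window t′≤a))))
    ... | inj₂ (u , u<b , refl) | inj₂ (u′ , u′<b , refl) =
      cong (suc a +_) (tl-injective u u′ u<b u′<b (trans (sym (w-tail u)) (trans eq (w-tail u′))))
    w-edge : ∀ r → r < L → E G (w r) (w (suc r)) ≡ just (flip^ r (col j))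
    w-edge r r<L with position r<L
    ... | inj₂ (u , u<b , refl) =
      trans (cong₂ (E G) (w-tail u) (trans (cong w (sym (+-suc (suc a) u))) (w-tail (suc u))))
            (trans (tl-edge u u<b) (cong (λ r → just (flip^ r (col j))) (+-comm u (suc a))))
    ... | inj₁ r≤a with m≤n⇒m<n∨m≡n r≤a
    ...   | inj₂ refl =
      trans (cong₂ (E G) (w-window ≤-refl) (trans (cong w (sym (+-identityʳ (suc a)))) (w-tail 0))) enter
    ...   | inj₁ r<a =
      trans (cong₂ (E G) (w-window r≤a) (trans (w-window r<a) (cong Z (+-suc j r))))
            (trans (col-edge (j + r)) (cong just (col-+ j r)))
    on-window : ∀ t → t ≤ a → OnCycle L (λ t → w (t % L)) (Z (j + t))
    on-window t t≤a = t , t<L , trans (cong w (m<n⇒m%n≡m t<L)) (w-window t≤a)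
      where
      t<L : t < L
      t<L = subst (t <_) a+b≡L (≤-trans (s≤s t≤a) (m≤m+n (suc a) b))
    on-tail : ∀ u → u < b → OnCycle L (λ t → w (t % L)) (tl u)
    on-tail u u<b = suc a + u , t<L , trans (cong w (m<n⇒m%n≡m t<L)) (w-tail u)
      where
      t<L : suc a + u < L
      t<L = subst (suc a + u <_) a+b≡L (+-monoʳ-< (suc a) u<b)

persistent-agreement⇒alternating : (p K : ℕ → Colour) (T : ℕ) →
  (∀ t → K (suc t) ≡ flip (K t)) →
  (∀ t → p t ≡ K t → p (suc t) ≡ K (suc t)) →
  (∀ t → p (t + suc T) ≡ p t) → (∀ t → K (t + suc T) ≡ K t) →
  ∀ t → p (suc t) ≡ flip (p t)
persistent-agreement⇒alternating p K T K-alt persists p-per K-per t with p (suc t) ≟ᶜ p t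
... | no  differ = ≢⇒≡flip differ
... | yes same   = ⊥-elim (flip-≢ (p t) (trans (sym flipped) same))
  where
  agree-from : ∀ {t₀} → p t₀ ≡ K t₀ → ∀ s → p (s + t₀) ≡ K (s + t₀)
  agree-from agree zero    = agree
  agree-from agree (suc s) = persists _ (agree-from agree s)
  agree-suc : p (suc t) ≡ K (suc t)
  agree-suc with p t ≟ᶜ K t
  ... | yes agree    = persists t agree
  ... | no  disagree = trans same (trans (≢⇒≡flip disagree) (sym (K-alt t)))
  around : t + suc T ≡ T + suc t
  around = trans (+-suc t T) (trans (cong suc (+-comm t T)) (sym (+-suc T t)))
  agree-t : p t ≡ K t
  agree-t = begin
    p t            ≡⟨ sym (p-per t) ⟩
    p (t + suc T)  ≡⟨ cong p around ⟩
    p (T + suc t)  ≡⟨ agree-from agree-suc T ⟩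
    K (T + suc t)  ≡⟨ cong K (sym around) ⟩
    K (t + suc T)  ≡⟨ K-per t ⟩
    K t            ∎
    where open ≡-Reasoning
  flipped : p (suc t) ≡ flip (p t)
  flipped = trans agree-suc (trans (K-alt t) (cong flip (sym agree-t)))

Descends : (ℕ → Bool) → ℕ → Set
Descends ψ d = ∀ x → ψ (x + d) ≡ true → ψ x ≡ true

descends-+ : ∀ ψ a b → Descends ψ a → Descends ψ b → Descends ψ (a + b)
descends-+ ψ a b down-a down-b x ψ[x+a+b] =
  down-a x (down-b (x + a) (subst (λ z → ψ z ≡ true) (sym (+-assoc x a b)) ψ[x+a+b]))

descends-* : ∀ ψ a → Descends ψ a → ∀ t → Descends ψ (t * a)
descends-* ψ a down-a zero    x ψ[x+0] = subst (λ z → ψ z ≡ true) (+-identityʳ x) ψ[x+0]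
descends-* ψ a down-a (suc t) = descends-+ ψ a (t * a) down-a (descends-* ψ a down-a t)

-- Descending by 2 + d and by d gives descending by 2 + d·P, i.e. by 2
-- modulo the period P; going down by 2 around the even period is going up.
descends⇒period-2 : ∀ m ψ d → (∀ x → ψ (x + 2 * suc m) ≡ ψ x) →
  Descends ψ (2 + d) → Descends ψ d → ∀ x → ψ (x + 2) ≡ ψ x
descends⇒period-2 m ψ d per down-2+d down-d x = ⇔→≡ (mk⇔ (down-2 x) up-2)
  where
  around-d : ∀ x d m → x + 2 + d * (2 * suc m) ≡ x + ((2 + d) + (2 * m + 1) * d)
  around-d = solve-∀
  down-2 : Descends ψ 2
  down-2 y ψ[y+2] = descends-+ ψ (2 + d) _ down-2+d (descends-* ψ d down-d (2 * m + 1)) y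
    (subst (λ z → ψ z ≡ true) (around-d y d m) (trans (periodic-* ψ (2 * suc m) per d (y + 2)) ψ[y+2]))
  up-2 : ψ x ≡ true → ψ (x + 2) ≡ true
  up-2 ψx = descends-* ψ 2 down-2 m (x + 2)
    (subst (λ z → ψ z ≡ true) (around-2 x m) (trans (per x) ψx))
    where
    around-2 : ∀ x m → x + 2 * suc m ≡ x + 2 + m * 2
    around-2 = solve-∀

Alternating : (ℕ → Bool) → Set
Alternating ψ = ∀ j → ψ (suc j) ≡ not (ψ j)

alternating-+even : ∀ (ψ : ℕ → Bool) → Alternating ψ → ∀ j s → ψ (j + 2 * s) ≡ ψ j
alternating-+even ψ alt j zero    = cong ψ (+-identityʳ j)
alternating-+even ψ alt j (suc s) = begin
  ψ (j + 2 * suc s)             ≡⟨ cong ψ (two-more j s) ⟩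
  ψ (suc (suc (j + 2 * s)))     ≡⟨ alt _ ⟩
  not (ψ (suc (j + 2 * s)))     ≡⟨ cong not (alt _) ⟩
  not (not (ψ (j + 2 * s)))     ≡⟨ not-involutive _ ⟩
  ψ (j + 2 * s)                 ≡⟨ alternating-+even ψ alt j s ⟩
  ψ j                           ∎
  where
  open ≡-Reasoning
  two-more : ∀ j s → j + 2 * suc s ≡ suc (suc (j + 2 * s))
  two-more = solve-∀

alternating-+odd : ∀ (ψ : ℕ → Bool) → Alternating ψ → ∀ j s → ψ (j + suc (2 * s)) ≡ not (ψ j)
alternating-+odd ψ alt j s =
  trans (cong ψ (+-suc j (2 * s))) (trans (alt _) (cong not (alternating-+even ψ alt j s)))

period-2⇒constant : ∀ (ψ : ℕ → Bool) → (∀ x → ψ (x + 2) ≡ ψ x) → ψ 1 ≡ ψ 0 → ∀ j → ψ j ≡ ψ 0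
period-2⇒constant ψ per same zero          = refl
period-2⇒constant ψ per same (suc zero)    = same
period-2⇒constant ψ per same (suc (suc j)) =
  trans (cong ψ (+-comm 2 j)) (trans (per j) (period-2⇒constant ψ per same j))

period-2⇒alternating : ∀ (ψ : ℕ → Bool) → (∀ x → ψ (x + 2) ≡ ψ x) → ψ 1 ≡ not (ψ 0) → Alternating ψ
period-2⇒alternating ψ per flips zero    = flips
period-2⇒alternating ψ per flips (suc j) = begin
  ψ (suc (suc j))       ≡⟨ cong ψ (+-comm 2 j) ⟩
  ψ (j + 2)             ≡⟨ per j ⟩
  ψ j                   ≡⟨ sym (not-involutive _) ⟩
  not (not (ψ j))       ≡⟨ cong not (sym (period-2⇒alternating ψ per flips j)) ⟩
  not (ψ (suc j))       ∎
  where open ≡-Reasoning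

exists-other-colour : ∀ (h : ℕ → Colour) B κ → ¬ (∀ x → x < B → h x ≡ κ) → ∃[ x ] (h x ≡ flip κ)
exists-other-colour h B κ not-all with all? {n = B} (λ k → h (toℕ k) ≟ᶜ κ)
... | yes all-κ = ⊥-elim (not-all (λ x x<B → subst (λ z → h z ≡ κ) (toℕ-fromℕ< x<B) (all-κ (fromℕ< x<B))))
... | no  some  with ¬∀⟶∃¬ B (λ k → h (toℕ k) ≡ κ) (λ k → h (toℕ k) ≟ᶜ κ) some
...   | k , hk≢κ = toℕ k , ≢⇒≡flip hk≢κ

NoGoodPair : {V : Set} → ColGraph V → ℕ → (ℕ → V) → ℕ → (ℕ → V) → Set
NoGoodPair G ℓ₁ c₁ ℓ₂ c₂ = ∀ κ v w v′ w′ →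
  OnCycle ℓ₁ c₁ v → OnCycle ℓ₂ c₂ w → E G v w ≡ just κ →
  CycNbr G ℓ₁ c₁ κ v v′ → CycNbr G ℓ₂ c₂ κ w w′ → E G v′ w′ ≢ just κ

¬GoodPair⇒NoGoodPair : ∀ {p q} (G : ColGraph (Fin p ⊎ Fin q)) ℓ₁ c₁ ℓ₂ c₂ →
  ¬ GoodPair G ℓ₁ c₁ ℓ₂ c₂ → NoGoodPair G ℓ₁ c₁ ℓ₂ c₂
¬GoodPair⇒NoGoodPair G ℓ₁ c₁ ℓ₂ c₂ ¬good κ v w v′ w′ on-v on-w vw nbr-v nbr-w v′w′ =
  ¬good (κ , v , w , v′ , w′ , on-v , on-w , vw , nbr-v , nbr-w , v′w′)

NoGoodPair-swap : ∀ {V} (G : ColGraph V) ℓ₁ c₁ ℓ₂ c₂ → NoGoodPair G ℓ₁ c₁ ℓ₂ c₂ → NoGoodPair G ℓ₂ c₂ ℓ₁ c₁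
NoGoodPair-swap G ℓ₁ c₁ ℓ₂ c₂ no-good κ v w v′ w′ on-v on-w vw nbr-v nbr-w v′w′ =
  no-good κ w v w′ v′ on-w on-v (trans (ColGraph.sym G w v) vw) nbr-w nbr-v (trans (ColGraph.sym G w′ v′) v′w′)

AltCycleThrough : {V : Set} → ColGraph V → ℕ → V → Set
AltCycleThrough G ℓ v = ∃[ c ] (AltCycle G ℓ c × OnCycle ℓ c v)

Bichromatic : (ℕ → Colour) → Set
Bichromatic h = ∃[ a ] ∃[ b ] (h a ≡ red × h b ≡ blue)

module TwoCycles {V : Set} (G : ColGraph V) (n m : ℕ) (X Y : ℕ → V)
  (cX : AltCycle G (2 * suc n) X) (cY : AltCycle G (2 * suc m) Y)
  (disjoint : ∀ i j → X i ≢ Y j)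
  (complete : ∀ i j → E G (X i) (Y j) ≢ nothing)
  (no-good-pair : NoGoodPair G (2 * suc n) X (2 * suc m) Y)
  where

  module X = AltCycleFacts cX
  module Y = AltCycleFacts cY

  N M : ℕ
  N = 2 * suc n
  M = 2 * suc m

  col₁ col₂ : ℕ → Colour
  col₁ = X.col
  col₂ = Y.col

  χ : ℕ → ℕ → Colour
  χ i j = fromMaybe red (E G (X i) (Y j))

  χ-edge : ∀ i j → E G (X i) (Y j) ≡ just (χ i j)
  χ-edge i j with E G (X i) (Y j) | complete i j
  ... | just κ  | _      = refl
  ... | nothing | exists = ⊥-elim (exists refl)

  χ-congˡ : ∀ {i i′} j → X i ≡ X i′ → χ i j ≡ χ i′ j
  χ-congˡ j eq = cong (λ v → fromMaybe red (E G v (Y j))) eq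

  χ-congʳ : ∀ i {j j′} → Y j ≡ Y j′ → χ i j ≡ χ i j′
  χ-congʳ i eq = cong (λ v → fromMaybe red (E G (X i) v)) eq

  forward-pair-forbidden : ∀ i j → col₁ i ≡ col₂ j → χ i j ≡ col₁ i → χ (suc i) (suc j) ≢ col₁ i
  forward-pair-forbidden i j same agree agree′ =
    no-good-pair (col₁ i) (X i) (Y j) (X (suc i)) (Y (suc j)) (X.on-cycle i) (Y.on-cycle j)
      (trans (χ-edge i j) (cong just agree))
      (i , refl , inj₁ refl , X.col-edge i)
      (j , refl , inj₁ refl , trans (Y.col-edge j) (cong just (sym same)))
      (trans (χ-edge (suc i) (suc j)) (cong just agree′))

  backward-pair-forbidden : ∀ i j → col₁ i ≡ flip (col₂ j) → χ i j ≡ col₁ i → χ (suc i) (j + (M ∸ 1)) ≢ col₁ i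
  backward-pair-forbidden i j opposite agree agree′ =
    no-good-pair (col₁ i) (X i) (Y j) (X (suc i)) (Y (j + (M ∸ 1))) (X.on-cycle i) (Y.on-cycle j)
      (trans (χ-edge i j) (cong just agree))
      (i , refl , inj₁ refl , X.col-edge i)
      (j , refl , inj₂ refl , trans (Y.back-edge j) (cong just (sym opposite)))
      (trans (χ-edge (suc i) (j + (M ∸ 1))) (cong just agree′))

  χ-flips-along : ∀ i (g : ℕ → ℕ) →
    (∀ t → χ (i + t) (g t) ≡ col₁ (i + t) → χ (suc (i + t)) (g (suc t)) ≢ col₁ (i + t)) →
    (∀ t → Y (g (t + N * M)) ≡ Y (g t)) →
    χ (suc i) (g 1) ≡ flip (χ i (g 0))
  χ-flips-along i g forbidden g-periodic =
    subst₂ (λ a b → χ a (g 1) ≡ flip (χ b (g 0))) (+-comm i 1) (+-identityʳ i)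
      (persistent-agreement⇒alternating p K (pred (N * M)) K-alt persists p-periodic K-periodic 0)
    where
    p K : ℕ → Colour
    p t = χ (i + t) (g t)
    K t = col₁ (i + t)
    K-alt : ∀ t → K (suc t) ≡ flip (K t)
    K-alt t = trans (cong col₁ (+-suc i t)) (X.col-suc (i + t))
    persists : ∀ t → p t ≡ K t → p (suc t) ≡ K (suc t)
    persists t agree = trans (cong (λ a → χ a (g (suc t))) (+-suc i t))
                         (trans (≢⇒≡flip (forbidden t agree)) (sym (K-alt t)))
    shift : ∀ t → i + (t + N * M) ≡ (i + t) + M * N
    shift t = trans (sym (+-assoc i t (N * M))) (cong ((i + t) +_) (*-comm N M))
    p-periodic : ∀ t → p (t + N * M) ≡ p t
    p-periodic t = trans (χ-congˡ _ (trans (cong X (shift t)) (periodic-* X N (AltCycle.periodic cX) M (i + t))))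
                         (χ-congʳ _ (g-periodic t))
    K-periodic : ∀ t → K (t + N * M) ≡ K t
    K-periodic t = trans (cong col₁ (shift t)) (periodic-* col₁ N X.col-+P M (i + t))

  χ-diagonal-flip : ∀ i j → col₁ i ≡ col₂ j → χ (suc i) (suc j) ≡ flip (χ i j)
  χ-diagonal-flip i j same =
    subst₂ (λ a b → χ (suc i) a ≡ flip (χ i b)) (+-comm j 1) (+-identityʳ j)
      (χ-flips-along i (j +_) forbidden periodic)
    where
    forbidden : ∀ t → χ (i + t) (j + t) ≡ col₁ (i + t) → χ (suc (i + t)) (j + suc t) ≢ col₁ (i + t)
    forbidden t agree = subst (λ a → χ (suc (i + t)) a ≢ col₁ (i + t)) (sym (+-suc j t))
      (forward-pair-forbidden (i + t) (j + t) (trans (X.col-+ i t) (trans (cong (flip^ t) same) (sym (Y.col-+ j t)))) agree)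
    periodic : ∀ t → Y (j + (t + N * M)) ≡ Y (j + t)
    periodic t = trans (cong Y (sym (+-assoc j t (N * M)))) (periodic-* Y M (AltCycle.periodic cY) N (j + t))

  col₂-back* : ∀ j t → col₂ (j + t * (M ∸ 1)) ≡ flip^ t (col₂ j)
  col₂-back* j zero    = cong col₂ (+-identityʳ j)
  col₂-back* j (suc t) = trans (cong col₂ (+-suc-* j t (M ∸ 1))) (trans (Y.col-+P∸1 _) (cong flip (col₂-back* j t)))

  χ-antidiagonal-flip : ∀ i j → col₁ i ≡ flip (col₂ j) → χ (suc i) (j + (M ∸ 1)) ≡ flip (χ i j)
  χ-antidiagonal-flip i j opposite =
    subst₂ (λ a b → χ (suc i) a ≡ flip (χ i b)) (cong (j +_) (*-identityˡ (M ∸ 1))) (+-identityʳ j)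
      (χ-flips-along i (λ t → j + t * (M ∸ 1)) forbidden periodic)
    where
    forbidden : ∀ t → χ (i + t) (j + t * (M ∸ 1)) ≡ col₁ (i + t) →
                χ (suc (i + t)) (j + suc t * (M ∸ 1)) ≢ col₁ (i + t)
    forbidden t agree = subst (λ a → χ (suc (i + t)) a ≢ col₁ (i + t)) (sym (+-suc-* j t (M ∸ 1)))
      (backward-pair-forbidden (i + t) (j + t * (M ∸ 1)) opposite-t agree)
      where
      opposite-t : col₁ (i + t) ≡ flip (col₂ (j + t * (M ∸ 1)))
      opposite-t = trans (X.col-+ i t) (trans (cong (flip^ t) opposite)
                     (trans (flip^-flip t (col₂ j)) (cong flip (sym (col₂-back* j t)))))
    around : ∀ j t B N M → j + (t + N * M) * B ≡ (j + t * B) + (N * B) * M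
    around = solve-∀
    periodic : ∀ t → Y (j + (t + N * M) * (M ∸ 1)) ≡ Y (j + t * (M ∸ 1))
    periodic t = trans (cong Y (around j t (M ∸ 1) N M)) (periodic-* Y M (AltCycle.periodic cY) (N * (M ∸ 1)) _)

  agree : ℕ → ℕ → Bool
  agree i j = χ i j ==ᶜ col₂ j

  agree-periodicʳ : ∀ i j → agree i (j + M) ≡ agree i j
  agree-periodicʳ i j = cong₂ _==ᶜ_ (χ-congʳ i (AltCycle.periodic cY j)) (Y.col-+P j)

  agree-periodicʳ-* : ∀ i q j → agree i (j + q * M) ≡ agree i j
  agree-periodicʳ-* i = periodic-* (agree i) M (agree-periodicʳ i)

  agree-diagonal : ∀ i j → col₁ i ≡ col₂ j → agree (suc i) (suc j) ≡ agree i j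
  agree-diagonal i j same = trans (cong₂ _==ᶜ_ (χ-diagonal-flip i j same) (Y.col-suc j)) (==ᶜ-flip _ _)

  agree-antidiagonal : ∀ i j → col₁ i ≡ flip (col₂ j) → agree (suc i) (j + (M ∸ 1)) ≡ agree i j
  agree-antidiagonal i j opposite =
    trans (cong₂ _==ᶜ_ (χ-antidiagonal-flip i j opposite) (Y.col-+P∸1 j)) (==ᶜ-flip _ _)

  around-once : ∀ i j → agree i j ≡ agree i (suc (j + (M ∸ 1)))
  around-once i j = trans (sym (agree-periodicʳ i j)) (cong (agree i) (+-suc j (M ∸ 1)))

  agree-next-row : ∀ i j → agree (suc i) j ≡ agree i (j + (M ∸ 1)) ⊎ agree (suc i) j ≡ agree i (suc j)
  agree-next-row i j with col₁ i ≟ᶜ col₂ (j + (M ∸ 1))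
  ... | yes same     = inj₁ (trans (around-once (suc i) j) (agree-diagonal i (j + (M ∸ 1)) same))
  ... | no  opposite = inj₂ (trans (around-once (suc i) j) (agree-antidiagonal i (suc j) opposite′))
    where
    opposite′ : col₁ i ≡ flip (col₂ (suc j))
    opposite′ = trans (≢⇒≡flip opposite)
                  (cong flip (trans (cong (λ r → col₂ (j + r)) Y.P∸1≡)
                    (trans (cong col₂ (+-suc j (2 * m))) (Y.col-+even (suc j) m))))

  agree-constant : ∀ b → (∀ j → agree 0 j ≡ b) → ∀ i j → agree i j ≡ b
  agree-constant b row₀ zero    j = row₀ j
  agree-constant b row₀ (suc i) j with agree-next-row i j
  ... | inj₁ back    = trans back (agree-constant b row₀ i _)
  ... | inj₂ forward = trans forward (agree-constant b row₀ i _)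

  next-row-flips : ∀ i → Alternating (agree i) → ∀ j → agree (suc i) j ≡ not (agree i j)
  next-row-flips i alt j with agree-next-row i j
  ... | inj₁ back    = trans back (trans (cong (λ r → agree i (j + r)) Y.P∸1≡) (alternating-+odd (agree i) alt j m))
  ... | inj₂ forward = trans forward (alt j)

  agree-alternating : Alternating (agree 0) → ∀ i → Alternating (agree i)
  agree-alternating row₀ zero    = row₀
  agree-alternating row₀ (suc i) j = begin
    agree (suc i) (suc j)      ≡⟨ next-row-flips i alt (suc j) ⟩
    not (agree i (suc j))      ≡⟨ cong not (alt j) ⟩
    not (not (agree i j))      ≡⟨ cong not (sym (next-row-flips i alt j)) ⟩
    not (agree (suc i) j)      ∎
    where
    open ≡-Reasoning
    alt : Alternating (agree i)
    alt = agree-alternating row₀ i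

  constant⇒¬bichromatic-column : ∀ b → (∀ i j → agree i j ≡ b) → ∀ j → ¬ Bichromatic (λ i → χ i j)
  constant⇒¬bichromatic-column b const j (i₁ , i₂ , red₁ , blue₂) = distinguishes (col₂ j)
    (trans (cong (_==ᶜ col₂ j) (sym red₁)) (trans (const i₁ j) (trans (sym (const i₂ j)) (cong (_==ᶜ col₂ j) blue₂))))
    where
    distinguishes : ∀ κ → (red ==ᶜ κ) ≢ (blue ==ᶜ κ)
    distinguishes red  ()
    distinguishes blue ()

  alternating⇒¬bichromatic-row : (∀ i → Alternating (agree i)) → ∀ i → ¬ Bichromatic (χ i)
  alternating⇒¬bichromatic-row alt i (j₁ , j₂ , red₁ , blue₂) =
    red≢blue (trans (sym red₁) (trans (row-constant j₁) (trans (sym (row-constant j₂)) blue₂)))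
    where
    red≢blue : red ≢ blue
    red≢blue ()
    same-next : ∀ j → χ i (suc j) ≡ χ i j
    same-next j = relative (χ i (suc j)) (χ i j) (col₂ j) (trans (cong (χ i (suc j) ==ᶜ_) (sym (Y.col-suc j))) (alt i j))
      where
      relative : ∀ κ κ′ ε → (κ ==ᶜ flip ε) ≡ not (κ′ ==ᶜ ε) → κ ≡ κ′
      relative red  red  ε     _  = refl
      relative blue blue ε     _  = refl
      relative red  blue red   ()
      relative red  blue blue  ()
      relative blue red  red   ()
      relative blue red  blue  ()
    row-constant : ∀ j → χ i j ≡ χ i 0
    row-constant zero    = refl
    row-constant (suc j) = trans (same-next j) (row-constant j)

  period-2⇒¬bichromatic : (∀ x → agree 0 (x + 2) ≡ agree 0 x) →
    ∀ i j → Bichromatic (χ i) → ¬ Bichromatic (λ i → χ i j)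
  period-2⇒¬bichromatic per i j row with agree 0 1 ≟ᵇ agree 0 0
  ... | yes same   = constant⇒¬bichromatic-column (agree 0 0)
                       (agree-constant _ (period-2⇒constant (agree 0) per same)) j
  ... | no  differ = ⊥-elim (alternating⇒¬bichromatic-row
                       (agree-alternating (period-2⇒alternating (agree 0) per (¬-not differ))) i row)

  Switch : ℕ → ℕ → ℕ → Set
  Switch d i j = agree i j ≡ false × agree i (j + d) ≡ true

  switch? : ∀ d i j → Dec (Switch d i j)
  switch? d i j = (agree i j ≟ᵇ false) ×-dec (agree i (j + d) ≟ᵇ true)

  switch-or-descends : ∀ d → (∃[ J ] Switch d 0 J) ⊎ Descends (agree 0) d
  switch-or-descends d with any? {n = M} (λ k → switch? d 0 (toℕ k))
  ... | yes (k , switch) = inj₁ (toℕ k , switch)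
  ... | no  none         = inj₂ descends
    where
    reduce : ∀ x → agree 0 x ≡ agree 0 (x % M)
    reduce x = trans (cong (agree 0) (m≡m%n+[m/n]*n x M)) (agree-periodicʳ-* 0 (x / M) (x % M))
    reduce-+d : ∀ x → agree 0 (x + d) ≡ agree 0 (x % M + d)
    reduce-+d x = trans (cong (λ z → agree 0 (z + d)) (m≡m%n+[m/n]*n x M))
                    (trans (cong (agree 0) (xy∙z≈xz∙y (x % M) (x / M * M) d)) (agree-periodicʳ-* 0 (x / M) (x % M + d)))
    descends : Descends (agree 0) d
    descends x up with agree 0 (x % M) in eq
    ... | true  = trans (reduce x) eq
    ... | false = ⊥-elim (none (fromℕ< (m%n<n x M) ,
                    subst (Switch d 0) (sym (toℕ-fromℕ< (m%n<n x M))) (eq , trans (sym (reduce-+d x)) up)))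

  -- The cycle y_j y_{j+1} … y_{j+2s+2} x_i.
  detour-via-vertex : ∀ s i j → s < m → χ i j ≡ flip (col₂ j) → χ i (j + 2 * suc s) ≡ col₂ j →
    ∃[ c ] (AltCycle G (2 * suc (suc s)) c × OnCycle (2 * suc (suc s)) c (X i) × OnCycle (2 * suc (suc s)) c (Y j))
  detour-via-vertex s i j s<m leave arrive
    with Y.window+tail⇒AltCycle s (2 * suc s) 1 j tail (*-monoʳ-< 2 (s≤s s<m)) (length s) refl
           (λ u u′ u<1 u′<1 _ → trans (n<1⇒n≡0 u<1) (sym (n<1⇒n≡0 u′<1))) off-Y enter exit
    where
    tail : ℕ → V
    tail zero    = X i
    tail (suc _) = Y j
    length : ∀ s → suc (2 * suc s) + 1 ≡ 2 * suc (suc s)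
    length = solve-∀
    off-Y : ∀ u t → u < 1 → tail u ≢ Y t
    off-Y zero    t _ = disjoint i t
    off-Y (suc u) t (s≤s ())
    enter : E G (Y (j + 2 * suc s)) (X i) ≡ just (flip^ (2 * suc s) (col₂ j))
    enter = trans (ColGraph.sym G _ _) (trans (χ-edge i _) (cong just (trans arrive (sym (flip^-even (suc s) _)))))
    exit : ∀ u → u < 1 → E G (tail u) (tail (suc u)) ≡ just (flip^ (u + suc (2 * suc s)) (col₂ j))
    exit zero    _ = trans (χ-edge i j) (cong just (trans leave (sym (flip^-odd (suc s) _))))
    exit (suc u) (s≤s ())
  ... | c , cycle , on-window , on-tail =
    c , cycle , on-tail 0 (s≤s z≤n) , subst (OnCycle _ c) (cong Y (+-identityʳ j)) (on-window 0 z≤n)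

  -- The cycle y_j y_{j+1} … y_{j+2s+1} x_p x_q.
  detour-via-edge : ∀ s p q j → s < m → X p ≢ X q → E G (X p) (X q) ≡ just (col₂ j) →
    χ p (j + suc (2 * s)) ≡ flip (col₂ j) → χ q j ≡ flip (col₂ j) →
    let L = 2 * suc (suc s) in
    ∃[ c ] (AltCycle G L c × OnCycle L c (X p) × OnCycle L c (X q) × OnCycle L c (Y j) × OnCycle L c (Y (suc j)))
  detour-via-edge s p q j s<m p≢q edge arrive leave
    with Y.window+tail⇒AltCycle s (suc (2 * s)) 2 j tail window<M (length s) refl tail-injective off-Y enter exit
    where
    tail : ℕ → V
    tail zero          = X p
    tail (suc zero)    = X q
    tail (suc (suc _)) = Y j
    length : ∀ s → suc (suc (2 * s)) + 2 ≡ 2 * suc (suc s)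
    length = solve-∀
    window<M : suc (2 * s) < M
    window<M = ≤-trans (≤-reflexive (two-more s)) (*-monoʳ-≤ 2 (m≤n⇒m≤1+n s<m))
      where
      two-more : ∀ s → suc (suc (2 * s)) ≡ 2 * suc s
      two-more = solve-∀
    tail-injective : ∀ u u′ → u < 2 → u′ < 2 → tail u ≡ tail u′ → u ≡ u′
    tail-injective zero       zero       _ _ _  = refl
    tail-injective zero       (suc zero) _ _ eq = ⊥-elim (p≢q eq)
    tail-injective (suc zero) zero       _ _ eq = ⊥-elim (p≢q (sym eq))
    tail-injective (suc zero) (suc zero) _ _ _  = refl
    tail-injective (suc (suc _)) _ (s≤s (s≤s ())) _ _
    tail-injective _ (suc (suc _)) _ (s≤s (s≤s ())) _
    off-Y : ∀ u t → u < 2 → tail u ≢ Y t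
    off-Y zero       t _ = disjoint p t
    off-Y (suc zero) t _ = disjoint q t
    off-Y (suc (suc _)) t (s≤s (s≤s ()))
    κ : Colour
    κ = col₂ j
    enter : E G (Y (j + suc (2 * s))) (X p) ≡ just (flip^ (suc (2 * s)) κ)
    enter = trans (ColGraph.sym G _ _) (trans (χ-edge p _) (cong just (trans arrive (sym (flip^-odd s κ)))))
    back-to-κ : flip (flip (flip^ (2 * s) κ)) ≡ κ
    back-to-κ = trans (flip-involutive _) (flip^-even s κ)
    exit : ∀ u → u < 2 → E G (tail u) (tail (suc u)) ≡ just (flip^ (u + suc (suc (2 * s))) κ)
    exit zero       _ = trans edge (cong just (sym back-to-κ))
    exit (suc zero) _ = trans (χ-edge q j) (cong just (trans leave (cong flip (sym back-to-κ))))
    exit (suc (suc _)) (s≤s (s≤s ()))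
  ... | c , cycle , on-window , on-tail =
    c , cycle , on-tail 0 (s≤s z≤n) , on-tail 1 (s≤s (s≤s z≤n)) ,
    subst (OnCycle _ c) (cong Y (+-identityʳ j)) (on-window 0 z≤n) ,
    subst (OnCycle _ c) (cong Y (+-comm j 1)) (on-window 1 (s≤s z≤n))

  Covers : ℕ → ℕ → ℕ → Set
  Covers ℓ i j = AltCycleThrough G ℓ (X i) × AltCycleThrough G ℓ (Y j)

  X-suc-≢ : ∀ i → X (suc i) ≢ X i
  X-suc-≢ i eq = 1+n≢0 (X.window-injective i 1<N 0<N (trans (cong X (+-comm i 1)) (trans eq (cong X (sym (+-identityʳ i))))))
    where
    1<N : 1 < N
    1<N = ≤-trans (s≤s (s≤s z≤n)) (AltCycle.long cX)
    0<N : 0 < N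
    0<N = ≤-trans (s≤s z≤n) 1<N

  switch-far⇒cycles : ∀ s → s < m → ∀ i j → Switch (2 * suc s) i j → Covers (2 * suc (suc s)) i j
  switch-far⇒cycles s s<m i j (off , on)
    with detour-via-vertex s i j s<m (==ᶜ-false off) (trans (==ᶜ-true on) (Y.col-+even j (suc s)))
  ... | c , cycle , on-X , on-Y = (c , cycle , on-X) , (c , cycle , on-Y)

  switch-near⇒cycles : ∀ s → s < m → ∀ i j → Switch (2 * s) i j → Covers (2 * suc (suc s)) i j
  switch-near⇒cycles s s<m i j (off , on) with col₁ i ≟ᶜ col₂ j
  ... | yes same
    with detour-via-edge s (suc i) i j s<m (X-suc-≢ i) edge arrive (==ᶜ-false off)
    where
    edge : E G (X (suc i)) (X i) ≡ just (col₂ j)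
    edge = trans (ColGraph.sym G _ _) (trans (X.col-edge i) (cong just same))
    arrive : χ (suc i) (j + suc (2 * s)) ≡ flip (col₂ j)
    arrive = trans (cong (χ (suc i)) (+-suc j (2 * s)))
               (trans (χ-diagonal-flip i (j + 2 * s) (trans same (sym (Y.col-+even j s))))
                 (cong flip (trans (==ᶜ-true on) (Y.col-+even j s))))
  ...   | c , cycle , _ , on-X , on-Y , _ = (c , cycle , on-X) , (c , cycle , on-Y)
  switch-near⇒cycles s s<m i j (off , on) | no differ
    with detour-via-edge s i (suc i) (j + (M ∸ 1)) s<m (X-suc-≢ i ∘ sym) edge arrive leave
    where
    opposite : col₁ i ≡ flip (col₂ j)
    opposite = ≢⇒≡flip differ
    back : col₂ (j + (M ∸ 1)) ≡ flip (col₂ j)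
    back = Y.col-+P∸1 j
    edge : E G (X i) (X (suc i)) ≡ just (col₂ (j + (M ∸ 1)))
    edge = trans (X.col-edge i) (cong just (trans opposite (sym back)))
    around : ∀ j B s → j + B + suc (2 * s) ≡ j + 2 * s + suc B
    around = solve-∀
    arrive : χ i (j + (M ∸ 1) + suc (2 * s)) ≡ flip (col₂ (j + (M ∸ 1)))
    arrive = trans (χ-congʳ i (trans (cong Y (around j (M ∸ 1) s)) (AltCycle.periodic cY (j + 2 * s))))
               (trans (==ᶜ-true on) (trans (Y.col-+even j s)
                 (trans (sym (flip-involutive _)) (cong flip (sym back)))))
    leave : χ (suc i) (j + (M ∸ 1)) ≡ flip (col₂ (j + (M ∸ 1)))
    leave = trans (χ-antidiagonal-flip i j opposite) (cong flip (trans (==ᶜ-false off) (sym back)))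
  ...   | c , cycle , on-X , _ , _ , on-Y =
    (c , cycle , on-X) , (c , cycle , subst (OnCycle _ c) (trans (cong Y (sym (+-suc j (M ∸ 1)))) (AltCycle.periodic cY j)) on-Y)

  agree-diagonal* : ∀ i j → col₁ i ≡ col₂ j → ∀ t → agree (i + t) (j + t) ≡ agree i j
  agree-diagonal* i j same zero    = cong₂ agree (+-identityʳ i) (+-identityʳ j)
  agree-diagonal* i j same (suc t) =
    trans (cong₂ agree (+-suc i t) (+-suc j t))
      (trans (agree-diagonal (i + t) (j + t) (trans (X.col-+ i t) (trans (cong (flip^ t) same) (sym (Y.col-+ j t)))))
        (agree-diagonal* i j same t))

  agree-antidiagonal* : ∀ t i j → col₁ i ≡ flip (col₂ (j + t)) → agree (i + t) j ≡ agree i (j + t)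
  agree-antidiagonal* zero    i j _        = cong₂ agree (+-identityʳ i) (sym (+-identityʳ j))
  agree-antidiagonal* (suc t) i j opposite = begin
    agree (i + suc t) j                    ≡⟨ cong (λ a → agree a j) (+-suc i t) ⟩
    agree (suc i + t) j                    ≡⟨ agree-antidiagonal* t (suc i) j opposite′ ⟩
    agree (suc i) (j + t)                  ≡⟨ sym (agree-periodicʳ (suc i) (j + t)) ⟩
    agree (suc i) (j + t + M)              ≡⟨ cong (agree (suc i)) (around j t (M ∸ 1)) ⟩
    agree (suc i) (j + suc t + (M ∸ 1))    ≡⟨ agree-antidiagonal i (j + suc t) opposite ⟩
    agree i (j + suc t)                    ∎
    where
    open ≡-Reasoning
    around : ∀ j t B → j + t + suc B ≡ j + suc t + B
    around = solve-∀
    opposite′ : col₁ (suc i) ≡ flip (col₂ (j + t))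
    opposite′ = trans (X.col-suc i) (trans (cong flip opposite)
                  (trans (flip-involutive _) (trans (cong col₂ (+-suc j t)) (Y.col-suc (j + t)))))

  switch-diagonal : ∀ e J → col₁ 0 ≡ col₂ J → Switch (2 * e) 0 J → ∀ t → Switch (2 * e) t (J + t)
  switch-diagonal e J same (off , on) t =
    trans (agree-diagonal* 0 J same t) off ,
    trans (cong (agree t) (xy∙z≈xz∙y J t (2 * e)))
      (trans (agree-diagonal* 0 (J + 2 * e) (trans same (sym (Y.col-+even J e))) t) on)

  switch-antidiagonal : ∀ e J → col₁ 0 ≡ flip (col₂ J) → Switch (2 * e) 0 J →
    ∀ t j q → j + t ≡ J + q * M → Switch (2 * e) t j
  switch-antidiagonal e J opposite (off , on) t j q j+t≡ =
    trans (agree-antidiagonal* t 0 j (facing j+t≡ refl))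
      (trans (cong (agree 0) j+t≡) (trans (agree-periodicʳ-* 0 q J) off)) ,
    trans (agree-antidiagonal* t 0 (j + 2 * e) (facing j+d+t≡ (Y.col-+even J e)))
      (trans (cong (agree 0) j+d+t≡) (trans (agree-periodicʳ-* 0 q (J + 2 * e)) on))
    where
    facing : ∀ {x y} → x ≡ y + q * M → col₂ y ≡ col₂ J → col₁ 0 ≡ flip (col₂ x)
    facing {x} {y} x≡ y∼J = trans opposite (cong flip (sym (trans (cong col₂ x≡) (trans (periodic-* col₂ M Y.col-+P q y) y∼J))))
    j+d+t≡ : j + 2 * e + t ≡ J + 2 * e + q * M
    j+d+t≡ = trans (xy∙z≈xz∙y j (2 * e) t) (trans (cong (_+ 2 * e) j+t≡) (xy∙z≈xz∙y J (q * M) (2 * e)))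

  switch-spreads : ∀ ℓ e → (∀ i j → Switch (2 * e) i j → Covers ℓ i j) → ∀ J → Switch (2 * e) 0 J →
    (∀ i → AltCycleThrough G ℓ (X i)) × (∀ j → AltCycleThrough G ℓ (Y j))
  switch-spreads ℓ e covers J switch with col₁ 0 ≟ᶜ col₂ J
  ... | yes same = (λ i → proj₁ (covers i (J + i) (switch-diagonal e J same switch i))) ,
                   (λ j → subst (AltCycleThrough G ℓ) (onto j)
                            (proj₂ (covers _ _ (switch-diagonal e J same switch (j + (M ∸ 1) * J)))))
    where
    around : ∀ J j B → J + (j + B * J) ≡ j + J * suc B
    around = solve-∀
    onto : ∀ j → Y (J + (j + (M ∸ 1) * J)) ≡ Y j
    onto j = trans (cong Y (around J j (M ∸ 1))) (periodic-* Y M (AltCycle.periodic cY) J j)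
  ... | no differ = (λ i → proj₁ (covers i _ (switch-antidiagonal e J opposite switch i _ i (row-around J i (M ∸ 1))))) ,
                    (λ j → proj₂ (covers _ j (switch-antidiagonal e J opposite switch _ j j (column-around J j (M ∸ 1)))))
    where
    opposite : col₁ 0 ≡ flip (col₂ J)
    opposite = ≢⇒≡flip differ
    row-around : ∀ J i B → J + B * i + i ≡ J + i * suc B
    row-around = solve-∀
    column-around : ∀ J j B → j + (J + B * j) ≡ J + j * suc B
    column-around = solve-∀

  nonSingular⇒bichromatic-row : ∀ i → NonSingular G M Y (X i) → Bichromatic (χ i)
  nonSingular⇒bichromatic-row i (¬red , ¬blue) = proj₁ some-red , proj₁ some-blue , proj₂ some-red , proj₂ some-blue
    where
    singular : ∀ κ → (∀ j → j < M → χ i j ≡ κ) → Singular G κ M Y (X i)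
    singular κ all-κ _ (j , j<M , refl) = trans (χ-edge i j) (cong just (all-κ j j<M))
    some-red : ∃[ j ] (χ i j ≡ red)
    some-red = exists-other-colour (χ i) M blue (¬blue ∘ singular blue)
    some-blue : ∃[ j ] (χ i j ≡ blue)
    some-blue = exists-other-colour (χ i) M red (¬red ∘ singular red)

  nonSingular⇒bichromatic-column : ∀ j → NonSingular G N X (Y j) → Bichromatic (λ i → χ i j)
  nonSingular⇒bichromatic-column j (¬red , ¬blue) = proj₁ some-red , proj₁ some-blue , proj₂ some-red , proj₂ some-blue
    where
    singular : ∀ κ → (∀ i → i < N → χ i j ≡ κ) → Singular G κ N X (Y j)
    singular κ all-κ _ (i , i<N , refl) = trans (ColGraph.sym G _ _) (trans (χ-edge i j) (cong just (all-κ i i<N)))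
    some-red : ∃[ i ] (χ i j ≡ red)
    some-red = exists-other-colour (λ i → χ i j) N blue (¬blue ∘ singular blue)
    some-blue : ∃[ i ] (χ i j ≡ blue)
    some-blue = exists-other-colour (λ i → χ i j) N red (¬red ∘ singular red)

  alt-cycles-through-all : ∀ s → s < m →
    (∃[ i ] NonSingular G M Y (X i)) → (∃[ j ] NonSingular G N X (Y j)) →
    (∀ i → AltCycleThrough G (2 * suc (suc s)) (X i)) × (∀ j → AltCycleThrough G (2 * suc (suc s)) (Y j))
  alt-cycles-through-all s s<m (i , nonSingularᵢ) (j , nonSingularⱼ)
    with switch-or-descends (2 * suc s) | switch-or-descends (2 * s)
  ... | inj₁ (J , switch) | _                 = switch-spreads _ (suc s) (switch-far⇒cycles s s<m) J switch
  ... | inj₂ _            | inj₁ (J , switch) = switch-spreads _ s (switch-near⇒cycles s s<m) J switch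
  ... | inj₂ down-far     | inj₂ down-near    =
    ⊥-elim (period-2⇒¬bichromatic period-2 i j (nonSingular⇒bichromatic-row i nonSingularᵢ)
              (nonSingular⇒bichromatic-column j nonSingularⱼ))
    where
    two-more : ∀ s → 2 * suc s ≡ 2 + 2 * s
    two-more = solve-∀
    period-2 : ∀ x → agree 0 (x + 2) ≡ agree 0 x
    period-2 = descends⇒period-2 m (agree 0) (2 * s) (agree-periodicʳ 0)
                 (subst (Descends (agree 0)) (two-more s) down-far) down-near

cover-sum : ∀ {p q} {P : Fin p ⊎ Fin q → Set} (x : ℕ → Fin p) (y : ℕ → Fin q) →
  (∀ a → ∃[ i ] (x i ≡ a)) → (∀ b → ∃[ j ] (y j ≡ b)) →
  (∀ i → P (inj₁ (x i))) → (∀ j → P (inj₂ (y j))) → ∀ v → P v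
cover-sum x y onto-x onto-y P-x P-y (inj₁ a) with onto-x a
... | i , refl = P-x i
cover-sum x y onto-x onto-y P-x P-y (inj₂ b) with onto-y b
... | j , refl = P-y j

≤⊔⇒≤⊎≤ : ∀ {k} a b → k ≤ a ⊔ b → k ≤ a ⊎ k ≤ b
≤⊔⇒≤⊎≤ a b k≤a⊔b with ≤-total a b
... | inj₁ a≤b = inj₂ (subst (_ ≤_) (m≤n⇒m⊔n≡n a≤b) k≤a⊔b)
... | inj₂ b≤a = inj₁ (subst (_ ≤_) (m≥n⇒m⊔n≡m b≤a) k≤a⊔b)

2*suc≰1 : ∀ z → 2 * suc z ≰ 1
2*suc≰1 z le with ≤-trans (*-monoʳ-≤ 2 (s≤s (z≤n {z}))) le
... | s≤s ()

mainTheorem4 : (p q n m : ℕ) (G : ColGraph (Fin p ⊎ Fin q)) →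
    InGenSum G →
    (x : ℕ → Fin p) → AltCycle G (2 * n) (λ i → inj₁ (x i)) →
    (∀ a → ∃[ i ] (x i ≡ a)) →
    (y : ℕ → Fin q) → AltCycle G (2 * m) (λ j → inj₂ (y j)) →
    (∀ b → ∃[ j ] (y j ≡ b)) →
    ¬ GoodPair G (2 * n) (λ i → inj₁ (x i)) (2 * m) (λ j → inj₂ (y j)) →
    ∃[ i ] NonSingular G (2 * m) (λ j → inj₂ (y j)) (inj₁ (x i)) →
    ∃[ j ] NonSingular G (2 * n) (λ i → inj₁ (x i)) (inj₂ (y j)) →
    ∀ (v : Fin p ⊎ Fin q) (k : ℕ) →
    2 * (n ⊓ m) ≤ k → k ≤ n ⊔ m →
    ∃[ c ] (AltCycle G (2 * k) c × OnCycle (2 * k) c v)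
mainTheorem4 p q zero    m       G _ _ cx _ _ _  _ _ _ _ _ _ _ _ with AltCycle.long cx
... | ()
mainTheorem4 p q (suc n) zero    G _ _ _  _ _ cy _ _ _ _ _ _ _ _ with AltCycle.long cy
... | ()
mainTheorem4 p q (suc n) (suc m) G _ _ _ _ _ _ _ _ _ _ _ zero          () _
mainTheorem4 p q (suc n) (suc m) G _ _ _ _ _ _ _ _ _ _ _ (suc zero)    lo _ = ⊥-elim (2*suc≰1 (n ⊓ m) lo)
mainTheorem4 p q (suc n) (suc m) G complete x cx onto-x y cy onto-y ¬good nsx nsy v (suc (suc s)) _ hi
  with ≤⊔⇒≤⊎≤ (suc n) (suc m) hi
... | inj₂ k≤m = cover-sum {P = AltCycleThrough G (2 * suc (suc s))} x y onto-x onto-y (proj₁ cycles) (proj₂ cycles) v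
  where
  cycles : (∀ i → AltCycleThrough G (2 * suc (suc s)) (inj₁ (x i))) × (∀ j → AltCycleThrough G (2 * suc (suc s)) (inj₂ (y j)))
  cycles = TwoCycles.alt-cycles-through-all G n m (λ i → inj₁ (x i)) (λ j → inj₂ (y j)) cx cy
             (λ _ _ ()) (λ i j → complete (x i) (y j)) (¬GoodPair⇒NoGoodPair G _ _ _ _ ¬good) s (s≤s⁻¹ k≤m) nsx nsy
... | inj₁ k≤n = cover-sum {P = AltCycleThrough G (2 * suc (suc s))} x y onto-x onto-y (proj₂ cycles) (proj₁ cycles) v
  where
  cycles : (∀ j → AltCycleThrough G (2 * suc (suc s)) (inj₂ (y j))) × (∀ i → AltCycleThrough G (2 * suc (suc s)) (inj₁ (x i)))
  cycles = TwoCycles.alt-cycles-through-all G m n (λ j → inj₂ (y j)) (λ i → inj₁ (x i)) cy cx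
             (λ _ _ ()) (λ j i → complete (x i) (y j) ∘ trans (ColGraph.sym G _ _))
             (NoGoodPair-swap G _ _ _ _ (¬GoodPair⇒NoGoodPair G _ _ _ _ ¬good)) s (s≤s⁻¹ k≤n) nsy nsx
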